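{- For every integer $k\ge 1$, $\alpha(k,k+2)$ is the string $0\,1\,2\,3\cdots(k-1)\,k\,k$ of length $k+2$, where $\alpha(k,p)$ denotes the lexicographically minimal critical string of a $k$-mismatch search scheme with $p$ parts (definitions in the context).
   Context: Fix integers $k\ge 0$ and $p\ge 1$. A search (with $p$ parts and at most $k$ errors) is a triple $S=(\pi,L,U)$ where $\pi=\pi(1)\cdots\pi(p)$ is a permutation of $\{1,\dots,p\}$ written as a string and satisfying the connectivity property: for every $i>1$, $\pi(i)$ equals either $\min_{j<i}\pi(j)-1$ or $\max_{j<i}\pi(j)+1$; and $L,U$ are strings of length $p$ over $\{0,\dots,k\}$. For a string $A$ of length $p$ over the nonnegative integers, its weight is $\sum_i A[i]$. The search $S$ covers $A$ if $L[i+1]\le \sum_{j=1}^{i} A[\pi(j)]\le U[i]$ for all $i=1,\dots,p$, with the convention $L[p+1]=0$. A $k$-mismatch search scheme with $p$ parts is a finite set $\mathcal S$ of such searches such that every string $A$ of length $p$ over the nonnegative integers of weight exactly $k$ is covered by some search in $\mathcal S$. The critical string of $\mathcal S$ is the lexicographically maximal $U$-string among the searches of $\mathcal S$. $\alpha(k,p)$ is the lexicographically minimal critical string over all $k$-mismatch search schemes with $p$ parts. -}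

module Defs where

open import Data.Nat using (ℕ; zero; suc; _+_; _≤_; _⊓_; _⊔_)
open import Data.Fin using (Fin; toℕ) renaming (suc to fsuc)
open import Data.Fin.Permutation using (Permutation′; _⟨$⟩ʳ_)
open import Data.List as List using (List; []; _∷_; take; foldr)
open import Data.Nat.ListAction using (sum)
open import Data.List.Membership.Propositional using (_∈_)
open import Data.List.Relation.Unary.Any using (Any)
open import Data.Vec as Vec using (Vec; lookup; _∷ʳ_; allFin)
open import Data.Vec.Relation.Unary.All using (All)
open import Data.Vec.Relation.Binary.Lex.NonStrict using (Lex-≤)
open import Data.Sum using (_⊎_)
open import Data.Product using (_×_; ∃-syntax)
open import Relation.Binary.PropositionalEquality using (_≡_)

-- Minimum / maximum of a list (only used on nonempty lists).
minOf : List ℕ → ℕ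
minOf []       = 0
minOf (x ∷ xs) = foldr _⊓_ x xs

maxOf : List ℕ → ℕ
maxOf = foldr _⊔_ 0

_≤lex_ : ∀ {n} → Vec ℕ n → Vec ℕ n → Set
_≤lex_ = Lex-≤ _≡_ _≤_

-- Positions are 0-based: position i : Fin p corresponds to i+1 in the paper,
-- and the permutation π maps into Fin p, i.e. values 0..p-1 instead of 1..p.

πList : ∀ {p} → Permutation′ p → List ℕ
πList {p} π = List.map (λ j → toℕ (π ⟨$⟩ʳ j)) (Vec.toList (allFin p))

-- Connectivity property: for every position i > 0 (0-based), π(i) equals
-- min_{j<i} π(j) - 1 or max_{j<i} π(j) + 1.
-- (π(i) = m - 1 is written π(i) + 1 = m to avoid truncated subtraction.)
Connected : ∀ {p} → Permutation′ p → Set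
Connected {p} π = ∀ (i : Fin p) (n : ℕ) → toℕ i ≡ suc n →
  let pre = take (suc n) (πList π)
      x   = toℕ (π ⟨$⟩ʳ i)
  in  suc x ≡ minOf pre ⊎ x ≡ suc (maxOf pre)

record Search (k p : ℕ) : Set where
  field
    π     : Permutation′ p
    conn  : Connected π
    L     : Vec ℕ p
    U     : Vec ℕ p
    L-bnd : All (_≤ k) L
    U-bnd : All (_≤ k) U
open Search public

weight : ∀ {p} → Vec ℕ p → ℕ
weight = Vec.sum

prefixSum : ∀ {p} → Permutation′ p → Vec ℕ p → Fin p → ℕ
prefixSum {p} π A i =
  sum (take (suc (toℕ i)) (List.map (λ j → lookup A (π ⟨$⟩ʳ j)) (Vec.toList (allFin p))))

Covers : ∀ {k p} → Search k p → Vec ℕ p → Set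
Covers S A = ∀ i →
  lookup (L S ∷ʳ 0) (fsuc i) ≤ prefixSum (π S) A i × prefixSum (π S) A i ≤ lookup (U S) i

IsSearchScheme : ∀ {k p} → List (Search k p) → Set
IsSearchScheme {k} {p} 𝒮 = ∀ (A : Vec ℕ p) → weight A ≡ k → Any (λ S → Covers S A) 𝒮

IsCriticalString : ∀ {k p} → List (Search k p) → Vec ℕ p → Set
IsCriticalString 𝒮 c = c ∈ List.map U 𝒮 × (∀ S → S ∈ 𝒮 → U S ≤lex c)

IsAlpha : (k p : ℕ) → Vec ℕ p → Set
IsAlpha k p w =
  (∃[ 𝒮 ] (IsSearchScheme {k} {p} 𝒮 × IsCriticalString 𝒮 w)) ×
  (∀ (𝒮 : List (Search k p)) (c : Vec ℕ p) →
     IsSearchScheme 𝒮 → IsCriticalString 𝒮 c → w ≤lex c)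

targetString : (k : ℕ) → Vec ℕ (suc (suc k))
targetString k = Vec.map toℕ (allFin (suc k)) ∷ʳ k

module Submission where

-- Lower bound: the permutation of a search is connected, so its first n+1 positions form an
-- interval that grows by one at an end in every step.  Along such an interval the prefix sums of
-- 0 1ᵏ 0 are at least n, except at the last step n = k+1, the only one at which both zeros can have
-- been reached, where the sum is k.  So every search covering 0 1ᵏ 0 has U ≥ 0 1 ⋯ k k pointwise.
-- Upper bound: a string of weight k with k+2 entries contains a block 0 1ʲ 0 starting at some
-- position a.  The search visiting a, a+1, …, k+1 and then a-1, …, 0, with L = 0 and
-- U = 0 1 ⋯ j j k ⋯ k, covers it, and these U are lexicographically at most 0 1 ⋯ k k,
-- with equality for j = k.

open import Defs
open import Data.Empty using (⊥)
open import Data.Fin using (Fin; toℕ; fromℕ; fromℕ<) renaming (zero to fzero; suc to fsuc)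
open import Data.Fin.Permutation using (Permutation′; _⟨$⟩ʳ_; permutation; reverse; _∘ₚ_)
open import Data.Fin.Properties using (toℕ<n; toℕ-fromℕ<; toℕ-fromℕ; toℕ-injective; opposite-prop)
open import Data.List as List using (List; []; _∷_; _∷ʳ_; [_]; take; drop; foldr; length)
open import Data.List.Membership.Propositional using (_∈_; find; lose)
open import Data.List.Membership.Propositional.Properties using (∈-allFin; ∈-map⁺; ∈-cartesianProductWith⁺; ∈-cartesianProductWith⁻)
open import Data.List.Properties using (foldr-∷ʳ; map-tabulate; take-suc-tabulate; take++drop≡id)
open import Data.Nat using (ℕ; zero; suc; pred; _+_; _∸_; _≤_; _≰_; _<_; _≥_; _⊓_; _⊔_; z≤n; s≤s; s≤s⁻¹)
open import Data.Nat.ListAction using (sum)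
open import Data.Nat.ListAction.Properties using (sum-++)
open import Data.Nat.Properties
open import Algebra.Properties.CommutativeMonoid.Sum +-0-commutativeMonoid using (sum-permute) renaming (sum to ∑)
open import Data.Nat.Tactic.RingSolver using (solve-∀)
open import Data.Product using (_×_; _,_; proj₂; ∃; ∃-syntax)
open import Data.Sum using (_⊎_; inj₁; inj₂)
open import Data.Unit using (tt)
open import Data.Vec as Vec using (Vec; []; _∷_; lookup; allFin)
open import Data.Vec.Properties using (tabulate-allFin; tabulate-cong; tabulate∘lookup; lookup∘tabulate; length-toList)
open import Data.Vec.Relation.Binary.Lex.NonStrict using (base; this; next) renaming (≤-trans to lex-trans)
open import Data.Vec.Relation.Unary.All using (All; []; _∷_)
open import Data.Vec.Relation.Unary.All.Properties using (tabulate⁺)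
open import Function using (_∘_)
open import Relation.Binary.PropositionalEquality hiding ([_])
open import Relation.Nullary using (yes; no)
open import Relation.Nullary.Negation using (contradiction)

δ : ℕ → ℕ → ℕ
δ zero    zero    = 1
δ zero    (suc _) = 0
δ (suc _) zero    = 0
δ (suc m) (suc n) = δ m n

δ-≢ : ∀ {m n} → m ≢ n → δ m n ≡ 0
δ-≢ {zero}  {zero}  m≢n = contradiction refl m≢n
δ-≢ {zero}  {suc n} _   = refl
δ-≢ {suc m} {zero}  _   = refl
δ-≢ {suc m} {suc n} m≢n = δ-≢ (m≢n ∘ cong suc)

δ≤1 : ∀ m n → δ m n ≤ 1
δ≤1 zero    zero    = ≤-refl
δ≤1 zero    (suc n) = z≤n
δ≤1 (suc m) zero    = z≤n
δ≤1 (suc m) (suc n) = δ≤1 m n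

foldUpTo : (ℕ → ℕ → ℕ) → (ℕ → ℕ) → ℕ → ℕ
foldUpTo _∙_ x zero    = x 0
foldUpTo _∙_ x (suc n) = foldUpTo _∙_ x n ∙ x (suc n)

minUpTo maxUpTo sumUpTo : (ℕ → ℕ) → ℕ → ℕ
minUpTo = foldUpTo _⊓_
maxUpTo = foldUpTo _⊔_
sumUpTo = foldUpTo _+_

foldUpTo-cong : ∀ _∙_ {x y : ℕ → ℕ} n → (∀ t → t ≤ n → x t ≡ y t) →
                foldUpTo _∙_ x n ≡ foldUpTo _∙_ y n
foldUpTo-cong _∙_ zero    x≗y = x≗y 0 z≤n
foldUpTo-cong _∙_ (suc n) x≗y =
  cong₂ _∙_ (foldUpTo-cong _∙_ n (λ t t≤n → x≗y t (m≤n⇒m≤1+n t≤n))) (x≗y (suc n) ≤-refl)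

minUpTo≤maxUpTo : ∀ x n → minUpTo x n ≤ maxUpTo x n
minUpTo≤maxUpTo x zero    = ≤-refl
minUpTo≤maxUpTo x (suc n) = ≤-trans (m⊓n≤m _ _) (≤-trans (minUpTo≤maxUpTo x n) (m≤m⊔n _ _))

maxUpTo-lub : ∀ x {b} n → (∀ t → t ≤ n → x t ≤ b) → maxUpTo x n ≤ b
maxUpTo-lub x zero    x≤b = x≤b 0 z≤n
maxUpTo-lub x (suc n) x≤b =
  ⊔-lub (maxUpTo-lub x n (λ t t≤n → x≤b t (m≤n⇒m≤1+n t≤n))) (x≤b (suc n) ≤-refl)

nth : List ℕ → ℕ → ℕ
nth []       _       = 0
nth (x ∷ xs) zero    = x
nth (x ∷ xs) (suc t) = nth xs t

nth-tabulate : ∀ {p} (f : Fin p → ℕ) i → nth (List.tabulate f) (toℕ i) ≡ f i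
nth-tabulate f fzero    = refl
nth-tabulate f (fsuc i) = nth-tabulate (f ∘ fsuc) i

nth-toList : ∀ {p} (A : Vec ℕ p) i → nth (Vec.toList A) (toℕ i) ≡ lookup A i
nth-toList (x ∷ A) fzero    = refl
nth-toList (x ∷ A) (fsuc i) = nth-toList A i

nth-drop : ∀ m xs t → nth (drop m xs) t ≡ nth xs (m + t)
nth-drop zero    xs       t = refl
nth-drop (suc m) []       t = refl
nth-drop (suc m) (x ∷ xs) t = nth-drop m xs t

<-length-drop : ∀ m (xs : List ℕ) {t} → t < length (drop m xs) → m + t < length xs
<-length-drop zero    xs       t<l = t<l
<-length-drop (suc m) (x ∷ xs) t<l = s≤s (<-length-drop m xs t<l)

-- πList π and the lists summed by prefixSum are of this form.
listOf : ∀ {p} → (Fin p → ℕ) → List ℕ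
listOf {p} f = List.map f (Vec.toList (allFin p))

toList-tabulate : ∀ {p} {A : Set} (f : Fin p → A) → Vec.toList (Vec.tabulate f) ≡ List.tabulate f
toList-tabulate {zero}  f = refl
toList-tabulate {suc p} f = cong (f fzero ∷_) (toList-tabulate (f ∘ fsuc))

listOf≡tabulate : ∀ {p} (f : Fin p → ℕ) → listOf f ≡ List.tabulate f
listOf≡tabulate f = trans (cong (List.map f) (toList-tabulate (λ i → i))) (map-tabulate (λ i → i) f)

nth-listOf : ∀ {p} (f : Fin p → ℕ) i → nth (listOf f) (toℕ i) ≡ f i
nth-listOf f i = trans (cong (λ xs → nth xs (toℕ i)) (listOf≡tabulate f)) (nth-tabulate f i)

foldr-∷ʳ-comm : ∀ (_∙_ : ℕ → ℕ → ℕ) → (∀ a b c → (a ∙ b) ∙ c ≡ a ∙ (b ∙ c)) → (∀ a b → a ∙ b ≡ b ∙ a) →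
                ∀ e xs y → foldr _∙_ e (xs ∷ʳ y) ≡ foldr _∙_ e xs ∙ y
foldr-∷ʳ-comm _∙_ assoc comm e xs y = trans (foldr-∷ʳ _∙_ e y xs) (seed xs)
  where
  seed : ∀ xs → foldr _∙_ (y ∙ e) xs ≡ foldr _∙_ e xs ∙ y
  seed []       = comm y e
  seed (x ∷ xs) = trans (cong (x ∙_) (seed xs)) (sym (assoc x _ y))

module _ (aggregate : List ℕ → ℕ) (_∙_ : ℕ → ℕ → ℕ)
         (aggregate-[] : ∀ y → aggregate [ y ] ≡ y)
         (aggregate-∷ʳ : ∀ z zs y → aggregate ((z ∷ zs) ∷ʳ y) ≡ aggregate (z ∷ zs) ∙ y) where

  aggregate-take-tabulate : ∀ {p} (f : Fin p → ℕ) n → n < p →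
    aggregate (take (suc n) (List.tabulate f)) ≡ foldUpTo _∙_ (nth (List.tabulate f)) n
  aggregate-take-tabulate {suc p} f zero    _   = aggregate-[] (f fzero)
  aggregate-take-tabulate {suc p} f (suc n) n<p = begin
    aggregate (take (suc (suc n)) (List.tabulate f))  ≡⟨ cong aggregate take-snoc ⟩
    aggregate (take (suc n) (List.tabulate f) ∷ʳ f i)  ≡⟨ aggregate-∷ʳ (f fzero) _ (f i) ⟩
    aggregate (take (suc n) (List.tabulate f)) ∙ f i   ≡⟨ cong₂ _∙_ (aggregate-take-tabulate f n (<⇒≤ n<p)) (sym nth≡) ⟩
    foldUpTo _∙_ (nth (List.tabulate f)) (suc n)       ∎
    where
    open ≡-Reasoning
    i = fromℕ< n<p
    take-snoc : take (suc (suc n)) (List.tabulate f) ≡ take (suc n) (List.tabulate f) ∷ʳ f i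
    take-snoc = subst (λ m → take (suc m) (List.tabulate f) ≡ take m (List.tabulate f) ∷ʳ f i)
                      (toℕ-fromℕ< n<p) (take-suc-tabulate f i)
    nth≡ : nth (List.tabulate f) (suc n) ≡ f i
    nth≡ = subst (λ m → nth (List.tabulate f) m ≡ f i) (toℕ-fromℕ< n<p) (nth-tabulate f i)

  aggregate-take : ∀ {p} (f : Fin p → ℕ) n → n < p →
                   aggregate (take (suc n) (listOf f)) ≡ foldUpTo _∙_ (nth (listOf f)) n
  aggregate-take f n n<p = subst (λ xs → aggregate (take (suc n) xs) ≡ foldUpTo _∙_ (nth xs) n)
                                 (sym (listOf≡tabulate f)) (aggregate-take-tabulate f n n<p)

minOf-take : ∀ {p} (f : Fin p → ℕ) n → n < p → minOf (take (suc n) (listOf f)) ≡ minUpTo (nth (listOf f)) n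
minOf-take = aggregate-take minOf _⊓_ (λ _ → refl) (λ z → foldr-∷ʳ-comm _⊓_ ⊓-assoc ⊓-comm z)

maxOf-take : ∀ {p} (f : Fin p → ℕ) n → n < p → maxOf (take (suc n) (listOf f)) ≡ maxUpTo (nth (listOf f)) n
maxOf-take = aggregate-take maxOf _⊔_ ⊔-identityʳ (λ z zs → foldr-∷ʳ-comm _⊔_ ⊔-assoc ⊔-comm 0 (z ∷ zs))

sum-take : ∀ {p} (f : Fin p → ℕ) n → n < p → sum (take (suc n) (listOf f)) ≡ sumUpTo (nth (listOf f)) n
sum-take = aggregate-take sum _+_ +-identityʳ (λ z zs → foldr-∷ʳ-comm _+_ +-assoc +-comm 0 (z ∷ zs))

-- Connected permutations

ExtendsAt : (ℕ → ℕ) → ℕ → Set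
ExtendsAt x n = suc (x (suc n)) ≡ minUpTo x n ⊎ x (suc n) ≡ suc (maxUpTo x n)

GrowsAtEnds : (ℕ → ℕ) → ℕ → Set
GrowsAtEnds x N = ∀ n → suc n < N → ExtendsAt x n

visits : ∀ {p} → Permutation′ p → ℕ → ℕ
visits π = nth (πList π)

connectedAt≡extendsAt : ∀ {p} (π : Permutation′ p) (i : Fin p) n → toℕ i ≡ suc n →
  (suc (toℕ (π ⟨$⟩ʳ i)) ≡ minOf (take (suc n) (πList π)) ⊎
     toℕ (π ⟨$⟩ʳ i) ≡ suc (maxOf (take (suc n) (πList π))))
  ≡ ExtendsAt (visits π) n
connectedAt≡extendsAt π i n i≡1+n =
  cong₂ _⊎_ (cong₂ _≡_ (cong suc πi≡) (minOf-take f n n<p)) (cong₂ _≡_ πi≡ (cong suc (maxOf-take f n n<p)))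
  where
  f = λ j → toℕ (π ⟨$⟩ʳ j)
  n<p = <⇒≤ (subst (_< _) i≡1+n (toℕ<n i))
  πi≡ : toℕ (π ⟨$⟩ʳ i) ≡ visits π (suc n)
  πi≡ = trans (sym (nth-listOf f i)) (cong (visits π) i≡1+n)

connected⇒growsAtEnds : ∀ {p} {π : Permutation′ p} → Connected π → GrowsAtEnds (visits π) p
connected⇒growsAtEnds {π = π} conn n 1+n<p =
  subst (λ P → P) (connectedAt≡extendsAt π i n (toℕ-fromℕ< 1+n<p)) (conn i n (toℕ-fromℕ< 1+n<p))
  where i = fromℕ< 1+n<p

growsAtEnds⇒connected : ∀ {p} {π : Permutation′ p} → GrowsAtEnds (visits π) p → Connected π
growsAtEnds⇒connected {π = π} grows i n i≡1+n =
  subst (λ P → P) (sym (connectedAt≡extendsAt π i n i≡1+n)) (grows n (subst (_< _) i≡1+n (toℕ<n i)))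

module _ (x : ℕ → ℕ) (n : ℕ) where

  extends-down : suc (x (suc n)) ≡ minUpTo x n →
                 minUpTo x (suc n) ≡ x (suc n) × maxUpTo x (suc n) ≡ maxUpTo x n
  extends-down x′<lo = m≥n⇒m⊓n≡n x′≤lo , m≥n⇒m⊔n≡m (≤-trans x′≤lo (minUpTo≤maxUpTo x n))
    where x′≤lo = ≤-trans (n≤1+n _) (≤-reflexive x′<lo)

  extends-up : x (suc n) ≡ suc (maxUpTo x n) →
               minUpTo x (suc n) ≡ minUpTo x n × maxUpTo x (suc n) ≡ x (suc n)
  extends-up hi<x′ = m≤n⇒m⊓n≡m (≤-trans lo≤hi hi≤x′) , m≤n⇒m⊔n≡n hi≤x′
    where
    lo≤hi = minUpTo≤maxUpTo x n
    hi≤x′ = ≤-trans (n≤1+n _) (≤-reflexive (sym hi<x′))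

private
  regroup-down : ∀ s w d e → s + w + d + e ≡ (s + 0 + e) + (w + d + 0)
  regroup-down = solve-∀

  regroup-up : ∀ s w d e → s + w + d + e ≡ (s + d + 0) + (w + 0 + e)
  regroup-up = solve-∀

module _ {x : ℕ → ℕ} {N : ℕ} (grows : GrowsAtEnds x N) where

  maxUpTo≡minUpTo+n : ∀ n → n < N → maxUpTo x n ≡ minUpTo x n + n
  maxUpTo≡minUpTo+n zero    _   = sym (+-identityʳ (x 0))
  maxUpTo≡minUpTo+n (suc n) 1+n<N with grows n 1+n<N
  ... | inj₁ down = let lo≡ , hi≡ = extends-down x n down in begin
    maxUpTo x (suc n)          ≡⟨ hi≡ ⟩
    maxUpTo x n                ≡⟨ maxUpTo≡minUpTo+n n (<⇒≤ 1+n<N) ⟩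
    minUpTo x n + n            ≡⟨ cong (_+ n) (sym down) ⟩
    suc (x (suc n)) + n        ≡⟨ sym (+-suc (x (suc n)) n) ⟩
    x (suc n) + suc n          ≡⟨ cong (_+ suc n) (sym lo≡) ⟩
    minUpTo x (suc n) + suc n  ∎
    where open ≡-Reasoning
  ... | inj₂ up = let lo≡ , hi≡ = extends-up x n up in begin
    maxUpTo x (suc n)          ≡⟨ hi≡ ⟩
    x (suc n)                  ≡⟨ up ⟩
    suc (maxUpTo x n)          ≡⟨ cong suc (maxUpTo≡minUpTo+n n (<⇒≤ 1+n<N)) ⟩
    suc (minUpTo x n + n)      ≡⟨ sym (+-suc (minUpTo x n) n) ⟩
    minUpTo x n + suc n        ≡⟨ cong (_+ suc n) (sym lo≡) ⟩
    minUpTo x (suc n) + suc n  ∎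
    where open ≡-Reasoning

  module _ {w : ℕ → ℕ} {K : ℕ} (x≤K : ∀ t → t < N → x t ≤ K)
           (w-split : ∀ t → t < N → w t + δ 0 (x t) + δ K (x t) ≡ 1) where

    maxUpTo≤ : ∀ n → n < N → maxUpTo x n ≤ K
    maxUpTo≤ n n<N = maxUpTo-lub x n (λ t t≤n → x≤K t (≤-<-trans t≤n n<N))

    sumUpTo+δ+δ : ∀ n → n < N → sumUpTo w n + δ 0 (minUpTo x n) + δ K (maxUpTo x n) ≡ suc n
    sumUpTo+δ+δ zero    0<N   = w-split 0 0<N
    sumUpTo+δ+δ (suc n) 1+n<N with grows n 1+n<N
    ... | inj₁ down = let lo≡ , hi≡ = extends-down x n down in begin
      s + w′ + δ 0 (minUpTo x (suc n)) + δ K (maxUpTo x (suc n))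
        ≡⟨ cong₂ (λ a b → s + w′ + δ 0 a + δ K b) lo≡ hi≡ ⟩
      s + w′ + δ 0 x′ + δ K hi              ≡⟨ regroup-down s w′ (δ 0 x′) (δ K hi) ⟩
      (s + 0 + δ K hi) + (w′ + δ 0 x′ + 0)
        ≡⟨ cong₂ (λ a b → (s + a + δ K hi) + (w′ + δ 0 x′ + b)) (cong (δ 0) down) (sym δKx′≡0) ⟩
      (s + δ 0 lo + δ K hi) + (w′ + δ 0 x′ + δ K x′)
        ≡⟨ cong₂ _+_ (sumUpTo+δ+δ n (<⇒≤ 1+n<N)) (w-split (suc n) 1+n<N) ⟩
      suc n + 1                             ≡⟨ +-comm (suc n) 1 ⟩
      suc (suc n)                           ∎
      where
      open ≡-Reasoning
      s = sumUpTo w n; w′ = w (suc n); x′ = x (suc n); lo = minUpTo x n; hi = maxUpTo x n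
      δKx′≡0 : δ K x′ ≡ 0
      δKx′≡0 = δ-≢ (≢-sym (<⇒≢ (<-≤-trans (≤-reflexive down)
                 (≤-trans (minUpTo≤maxUpTo x n) (maxUpTo≤ n (<⇒≤ 1+n<N))))))
    ... | inj₂ up = let lo≡ , hi≡ = extends-up x n up in begin
      s + w′ + δ 0 (minUpTo x (suc n)) + δ K (maxUpTo x (suc n))
        ≡⟨ cong₂ (λ a b → s + w′ + δ 0 a + δ K b) lo≡ hi≡ ⟩
      s + w′ + δ 0 lo + δ K x′              ≡⟨ regroup-up s w′ (δ 0 lo) (δ K x′) ⟩
      (s + δ 0 lo + 0) + (w′ + 0 + δ K x′)
        ≡⟨ cong₂ (λ a b → (s + δ 0 lo + a) + (w′ + b + δ K x′)) (sym δKhi≡0) (cong (δ 0) (sym up)) ⟩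
      (s + δ 0 lo + δ K hi) + (w′ + δ 0 x′ + δ K x′)
        ≡⟨ cong₂ _+_ (sumUpTo+δ+δ n (<⇒≤ 1+n<N)) (w-split (suc n) 1+n<N) ⟩
      suc n + 1                             ≡⟨ +-comm (suc n) 1 ⟩
      suc (suc n)                           ∎
      where
      open ≡-Reasoning
      s = sumUpTo w n; w′ = w (suc n); x′ = x (suc n); lo = minUpTo x n; hi = maxUpTo x n
      δKhi≡0 : δ K hi ≡ 0
      δKhi≡0 = δ-≢ (≢-sym (<⇒≢ (<-≤-trans (≤-reflexive (sym up)) (x≤K (suc n) 1+n<N))))

    private
      1+n≤sumUpTo+c : ∀ n → n < N → ∀ {c} → δ 0 (minUpTo x n) + δ K (maxUpTo x n) ≤ c → suc n ≤ sumUpTo w n + c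
      1+n≤sumUpTo+c n n<N δ+δ≤c = ≤-trans (≤-reflexive (trans (sym (sumUpTo+δ+δ n n<N)) (+-assoc (sumUpTo w n) _ _)))
                                         (+-monoʳ-≤ (sumUpTo w n) δ+δ≤c)

      δ+δ≤1 : ∀ n → n < N → n < K → δ 0 (minUpTo x n) + δ K (maxUpTo x n) ≤ 1
      δ+δ≤1 n n<N n<K with minUpTo x n in lo≡
      ... | suc _ = δ≤1 K _
      ... | zero  = ≤-reflexive (cong suc (δ-≢ (≢-sym (<⇒≢ (subst (_< K) (sym hi≡n) n<K)))))
        where
        hi≡n : maxUpTo x n ≡ n
        hi≡n = trans (maxUpTo≡minUpTo+n n n<N) (cong (_+ n) lo≡)

    ⊓pred≤sumUpTo : ∀ n → n < N → n ⊓ pred K ≤ sumUpTo w n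
    ⊓pred≤sumUpTo n n<N with n <? K
    ... | yes n<K = ≤-trans (m⊓n≤m n _)
                    (s≤s⁻¹ (subst (suc n ≤_) (+-comm (sumUpTo w n) 1) (1+n≤sumUpTo+c n n<N (δ+δ≤1 n n<N n<K))))
    ... | no  n≮K = ≤-trans (m⊓n≤n n _) (≤-trans (pred-mono-≤ (≮⇒≥ n≮K))
                    (pred-mono-≤ (s≤s⁻¹ (subst (suc n ≤_) (+-comm (sumUpTo w n) 2)
                      (1+n≤sumUpTo+c n n<N (+-mono-≤ (δ≤1 0 (minUpTo x n)) (δ≤1 K (maxUpTo x n))))))))

-- The lower bound

nth-listOf< : ∀ {p} (f : Fin p → ℕ) {t} (t<p : t < p) → nth (listOf f) t ≡ f (fromℕ< t<p)
nth-listOf< f t<p = subst (λ m → nth (listOf f) m ≡ f (fromℕ< t<p)) (toℕ-fromℕ< t<p) (nth-listOf f _)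

prefixSum≡sumUpTo : ∀ {p} (π : Permutation′ p) (A : Vec ℕ p) i →
                    prefixSum π A i ≡ sumUpTo (nth (listOf (λ j → lookup A (π ⟨$⟩ʳ j)))) (toℕ i)
prefixSum≡sumUpTo π A i = sum-take _ (toℕ i) (toℕ<n i)

≤lex-intro : ∀ {n} (u v : Vec ℕ n) →
             (∀ i → (∀ j → toℕ j < toℕ i → lookup u j ≡ lookup v j) → lookup u i ≤ lookup v i) → u ≤lex v
≤lex-intro []       []       _       = base tt
≤lex-intro (x ∷ xs) (y ∷ ys) u≤v with x ≟ y
... | yes x≡y = next x≡y (≤lex-intro xs ys (λ i agree → u≤v (fsuc i) λ { fzero _ → x≡y ; (fsuc j) j<i → agree j (s≤s⁻¹ j<i) }))
... | no  x≢y = this (u≤v fzero (λ _ ()) , x≢y) refl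

lookup-targetString : ∀ k i → lookup (targetString k) i ≡ toℕ i ⊓ k
lookup-targetString k i = trans (cong (λ v → lookup (v Vec.∷ʳ k) i) (sym (tabulate-allFin toℕ))) (go k (λ t → t) i)
  where
  go : ∀ m (f : ℕ → ℕ) (i : Fin (suc (suc m))) → lookup (Vec.tabulate (f ∘ toℕ) Vec.∷ʳ f m) i ≡ f (toℕ i ⊓ m)
  go m       f fzero           = refl
  go zero    f (fsuc fzero)    = refl
  go (suc m) f (fsuc i)        = go m (f ∘ suc) i

onesBetweenZeros : (k : ℕ) → Vec ℕ (suc (suc k))
onesBetweenZeros k = 0 ∷ (Vec.replicate k 1 Vec.∷ʳ 0)

weight-onesBetweenZeros : ∀ k → weight (onesBetweenZeros k) ≡ k
weight-onesBetweenZeros zero    = refl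
weight-onesBetweenZeros (suc k) = cong suc (weight-onesBetweenZeros k)

lookup-onesBetweenZeros : ∀ k i →
  lookup (onesBetweenZeros k) i + δ 0 (toℕ i) + δ (suc k) (toℕ i) ≡ 1
lookup-onesBetweenZeros k fzero    = refl
lookup-onesBetweenZeros k (fsuc i) = trans (cong (_+ δ k (toℕ i)) (+-identityʳ _)) (go k i)
  where
  go : ∀ k (i : Fin (suc k)) → lookup (Vec.replicate k 1 Vec.∷ʳ 0) i + δ k (toℕ i) ≡ 1
  go zero    fzero    = refl
  go (suc k) fzero    = refl
  go (suc k) (fsuc i) = go k i

⊓≤prefixSum-onesBetweenZeros : ∀ k {π : Permutation′ (suc (suc k))} → Connected π →
                               ∀ i → toℕ i ⊓ k ≤ prefixSum π (onesBetweenZeros k) i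
⊓≤prefixSum-onesBetweenZeros k {π} conn i =
  subst (toℕ i ⊓ k ≤_) (sym (prefixSum≡sumUpTo π A i))
    (⊓pred≤sumUpTo (connected⇒growsAtEnds {π = π} conn) visits≤ split (toℕ i) (toℕ<n i))
  where
  A = onesBetweenZeros k
  visits≤ : ∀ t → t < suc (suc k) → visits π t ≤ suc k
  visits≤ t t<p = subst (_≤ suc k) (sym (nth-listOf< _ t<p)) (s≤s⁻¹ (toℕ<n (π ⟨$⟩ʳ fromℕ< t<p)))
  split : ∀ t → t < suc (suc k) →
          nth (listOf (λ j → lookup A (π ⟨$⟩ʳ j))) t + δ 0 (visits π t) + δ (suc k) (visits π t) ≡ 1
  split t t<p = subst₂ (λ a y → a + δ 0 y + δ (suc k) y ≡ 1) (sym (nth-listOf< _ t<p)) (sym (nth-listOf< _ t<p))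
                       (lookup-onesBetweenZeros k (π ⟨$⟩ʳ fromℕ< t<p))

targetString-≤lex-critical : ∀ k (𝒮 : List (Search k (suc (suc k)))) c →
                             IsSearchScheme 𝒮 → IsCriticalString 𝒮 c → targetString k ≤lex c
targetString-≤lex-critical k 𝒮 c scheme (_ , U≤c) with find (scheme (onesBetweenZeros k) (weight-onesBetweenZeros k))
... | S , S∈𝒮 , covers = lex-trans ≤-isPartialOrder target≤U (U≤c S S∈𝒮)
  where
  target≤U : targetString k ≤lex U S
  target≤U = ≤lex-intro _ _ λ i _ → subst (_≤ lookup (U S) i) (sym (lookup-targetString k i))
    (≤-trans (⊓≤prefixSum-onesBetweenZeros k {π S} (conn S) i) (proj₂ (covers i)))

-- Blocks 0 1ʲ 0

OnesThenZero : List ℕ → ℕ → Set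
OnesThenZero xs r = (∀ t → t < r → nth xs t ≡ 1) × nth xs r ≡ 0 × r < length xs

ZeroOnesZero : List ℕ → ℕ → Set
ZeroOnesZero []       j = ⊥
ZeroOnesZero (z ∷ zs) j = z ≡ 0 × OnesThenZero zs j

Window : List ℕ → ℕ → ℕ → Set
Window xs a j = ZeroOnesZero (drop a xs) j

-- Some two consecutive zeros have only ones between them: otherwise each of the gaps between
-- consecutive zeros would carry an extra unit of weight.
mutual
  window : ∀ xs → 2 + sum xs ≤ length xs → ∃[ a ] ∃[ j ] Window xs a j
  window (zero  ∷ ys) (s≤s 1+Σ≤len) with onesThenZero-or-window ys 1+Σ≤len
  ... | inj₁ (j , ones)    = 0 , j , refl , ones
  ... | inj₂ (a , j , win) = suc a , j , win
  window (suc m ∷ ys) (s≤s 2+m+Σ≤len) with window ys (≤-trans (s≤s (s≤s (m≤n+m (sum ys) m))) 2+m+Σ≤len)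
  ... | a , j , win = suc a , j , win

  onesThenZero-or-window : ∀ xs → 1 + sum xs ≤ length xs → ∃ (OnesThenZero xs) ⊎ ∃[ a ] ∃[ j ] Window xs a j
  onesThenZero-or-window (zero ∷ ys) _ = inj₁ (0 , (λ _ ()) , refl , s≤s z≤n)
  onesThenZero-or-window (suc zero ∷ ys) (s≤s 1+Σ≤len) with onesThenZero-or-window ys 1+Σ≤len
  ... | inj₁ (r , ones , last , r<len) = inj₁ (suc r , (λ { zero _ → refl ; (suc t) t<r → ones t (s≤s⁻¹ t<r) }) , last , s≤s r<len)
  ... | inj₂ (a , j , win)             = inj₂ (suc a , j , win)
  onesThenZero-or-window (suc (suc m) ∷ ys) (s≤s 2+m+Σ≤len)
    with window ys (≤-trans (s≤s (s≤s (m≤n+m (sum ys) m))) 2+m+Σ≤len)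
  ... | a , j , win = inj₂ (suc a , j , win)

window-inside : ∀ xs {a j} → Window xs a j → a + suc j < length xs
window-inside xs {a} win = <-length-drop a xs (inside (drop a xs) win)
  where
  inside : ∀ zs {j} → ZeroOnesZero zs j → suc j < length zs
  inside (z ∷ zs) (_ , _ , _ , j<len) = s≤s j<len

sumUpTo-zeroOnesZero : ∀ zs {j} → ZeroOnesZero zs j → ∀ n → n ≤ suc j → sumUpTo (nth zs) n ≡ n ⊓ j
sumUpTo-zeroOnesZero (z ∷ zs) (z≡0 , _ , _ , _) zero _ = z≡0
sumUpTo-zeroOnesZero (z ∷ zs) {j} block@(_ , ones , last , _) (suc n) 1+n≤1+j
  with m<1+n⇒m<n∨m≡n 1+n≤1+j
... | inj₁ n<j  = begin
  sumUpTo (nth (z ∷ zs)) n + nth zs n  ≡⟨ cong₂ _+_ (sumUpTo-zeroOnesZero (z ∷ zs) block n (<⇒≤ 1+n≤1+j)) (ones n n<j) ⟩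
  n ⊓ j + 1                            ≡⟨ cong (_+ 1) (m≤n⇒m⊓n≡m (<⇒≤ n<j)) ⟩
  n + 1                                ≡⟨ +-comm n 1 ⟩
  suc n                                ≡⟨ sym (m≤n⇒m⊓n≡m n<j) ⟩
  suc n ⊓ j                            ∎
  where open ≡-Reasoning
... | inj₂ refl = begin
  sumUpTo (nth (z ∷ zs)) n + nth zs n  ≡⟨ cong₂ _+_ (sumUpTo-zeroOnesZero (z ∷ zs) block n (<⇒≤ 1+n≤1+j)) last ⟩
  n ⊓ n + 0                            ≡⟨ +-identityʳ _ ⟩
  n ⊓ n                                ≡⟨ ⊓-idem n ⟩
  n                                    ≡⟨ sym (m≥n⇒m⊓n≡n (n≤1+n n)) ⟩
  suc n ⊓ n                            ∎
  where open ≡-Reasoning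

-- Block searches

reflectFrom : ℕ → ℕ → ℕ → ℕ
reflectFrom K a y with y <? a
... | yes _ = y
... | no  _ = K + a ∸ y

reflectFrom-< : ∀ K {a y} → y < a → reflectFrom K a y ≡ y
reflectFrom-< K {a} {y} y<a with y <? a
... | yes _   = refl
... | no  y≮a = contradiction y<a y≮a

reflectFrom-≥ : ∀ K {a y} → a ≤ y → reflectFrom K a y ≡ K + a ∸ y
reflectFrom-≥ K {a} {y} a≤y with y <? a
... | yes y<a = contradiction a≤y (<⇒≱ y<a)
... | no  _   = refl

reflectFrom-≤ : ∀ K a {y} → y ≤ K → reflectFrom K a y ≤ K
reflectFrom-≤ K a {y} y≤K with y <? a
... | yes _   = y≤K
... | no  y≮a = ≤-trans (∸-monoʳ-≤ (K + a) (≮⇒≥ y≮a)) (≤-reflexive (m+n∸n≡m K a))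

reflectFrom-involutive : ∀ K a {y} → y ≤ K → reflectFrom K a (reflectFrom K a y) ≡ y
reflectFrom-involutive K a {y} y≤K with y <? a
... | yes y<a = reflectFrom-< K y<a
... | no  y≮a = trans (reflectFrom-≥ K a≤y′) (m∸[m∸n]≡n (≤-trans y≤K (m≤m+n K a)))
  where
  a≤y′ : a ≤ K + a ∸ y
  a≤y′ = subst (a ≤_) (sym (+-∸-comm a y≤K)) (m≤n+m a (K ∸ y))

reflectFromₚ : ∀ K → ℕ → Permutation′ (suc K)
reflectFromₚ K a = permutation f f f∘f≗id f∘f≗id
  where
  f : Fin (suc K) → Fin (suc K)
  f i = fromℕ< (s≤s (reflectFrom-≤ K a (s≤s⁻¹ (toℕ<n i))))
  f∘f≗id : ∀ i → f (f i) ≡ i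
  f∘f≗id i = toℕ-injective (trans (toℕ-fromℕ< _)
    (trans (cong (reflectFrom K a) (toℕ-fromℕ< _)) (reflectFrom-involutive K a (s≤s⁻¹ (toℕ<n i)))))

-- Visits a, a+1, …, K and then a-1, …, 0: reversing 0 … K and then the block a … K back.
blockOrder : ∀ K → ℕ → Permutation′ (suc K)
blockOrder K a = reverse ∘ₚ reflectFromₚ K a

toℕ-blockOrder : ∀ K a i → toℕ (blockOrder K a ⟨$⟩ʳ i) ≡ reflectFrom K a (K ∸ toℕ i)
toℕ-blockOrder K a i = trans (toℕ-fromℕ< _) (cong (reflectFrom K a) (opposite-prop i))

module _ (K a : ℕ) where

  private
    x : ℕ → ℕ
    x = visits (blockOrder K a)

  visits-blockOrder : ∀ t → t ≤ K → x t ≡ reflectFrom K a (K ∸ t)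
  visits-blockOrder t t≤K = trans (nth-listOf< _ (s≤s t≤K))
    (trans (toℕ-blockOrder K a (fromℕ< (s≤s t≤K))) (cong (λ m → reflectFrom K a (K ∸ m)) (toℕ-fromℕ< (s≤s t≤K))))

  visits-blockOrder-up : ∀ t → a + t ≤ K → x t ≡ a + t
  visits-blockOrder-up t a+t≤K = begin
    x t                        ≡⟨ visits-blockOrder t t≤K ⟩
    reflectFrom K a (K ∸ t)    ≡⟨ reflectFrom-≥ K (m+n≤o⇒m≤o∸n a a+t≤K) ⟩
    K + a ∸ (K ∸ t)            ≡⟨ +-∸-comm a (m∸n≤m K t) ⟩
    K ∸ (K ∸ t) + a            ≡⟨ cong (_+ a) (m∸[m∸n]≡n t≤K) ⟩
    t + a                      ≡⟨ +-comm t a ⟩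
    a + t                      ∎
    where
    open ≡-Reasoning
    t≤K = m+n≤o⇒n≤o a a+t≤K

  visits-blockOrder-down : ∀ t → K < a + t → t ≤ K → x t ≡ K ∸ t
  visits-blockOrder-down t K<a+t t≤K = trans (visits-blockOrder t t≤K) (reflectFrom-< K K∸t<a)
    where
    K∸t<a : K ∸ t < a
    K∸t<a = +-cancelʳ-< t (K ∸ t) a (subst (_< a + t) (sym (m∸n+n≡m t≤K)) K<a+t)

  maxUpTo-blockOrder : ∀ n → a + n ≤ K → maxUpTo x n ≡ a + n
  maxUpTo-blockOrder zero    a+0≤K   = visits-blockOrder-up 0 a+0≤K
  maxUpTo-blockOrder (suc n) a+1+n≤K = begin
    maxUpTo x n ⊔ x (suc n)    ≡⟨ cong₂ _⊔_ (maxUpTo-blockOrder n a+n≤K) (visits-blockOrder-up (suc n) a+1+n≤K) ⟩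
    (a + n) ⊔ (a + suc n)      ≡⟨ m≤n⇒m⊔n≡n (+-monoʳ-≤ a (n≤1+n n)) ⟩
    a + suc n                  ∎
    where
    open ≡-Reasoning
    a+n≤K = ≤-trans (+-monoʳ-≤ a (n≤1+n n)) a+1+n≤K

  minUpTo-blockOrder-up : ∀ n → a + n ≤ K → minUpTo x n ≡ a
  minUpTo-blockOrder-up zero    a+0≤K   = trans (visits-blockOrder-up 0 a+0≤K) (+-identityʳ a)
  minUpTo-blockOrder-up (suc n) a+1+n≤K = begin
    minUpTo x n ⊓ x (suc n)    ≡⟨ cong₂ _⊓_ (minUpTo-blockOrder-up n a+n≤K) (visits-blockOrder-up (suc n) a+1+n≤K) ⟩
    a ⊓ (a + suc n)            ≡⟨ m≤n⇒m⊓n≡m (m≤m+n a (suc n)) ⟩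
    a                          ∎
    where
    open ≡-Reasoning
    a+n≤K = ≤-trans (+-monoʳ-≤ a (n≤1+n n)) a+1+n≤K

  minUpTo-blockOrder-down : a ≤ K → ∀ n → K ≤ a + n → n ≤ K → minUpTo x n ≡ K ∸ n
  minUpTo-blockOrder-down a≤K n K≤a+n n≤K with a + n ≤? K
  ... | yes a+n≤K = trans (minUpTo-blockOrder-up n a+n≤K)
                          (sym (trans (cong (_∸ n) (sym (≤-antisym a+n≤K K≤a+n))) (m+n∸n≡m a n)))
  minUpTo-blockOrder-down a≤K zero K≤a+0 _ | no a+0≰K = contradiction (≤-trans (≤-reflexive (+-identityʳ a)) a≤K) a+0≰K
  minUpTo-blockOrder-down a≤K (suc n) _ 1+n≤K | no a+1+n≰K = begin
    minUpTo x n ⊓ x (suc n)    ≡⟨ cong₂ _⊓_ (minUpTo-blockOrder-down a≤K n K≤a+n (<⇒≤ 1+n≤K))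
                                            (visits-blockOrder-down (suc n) (≰⇒> a+1+n≰K) 1+n≤K) ⟩
    (K ∸ n) ⊓ (K ∸ suc n)      ≡⟨ m≥n⇒m⊓n≡n (∸-monoʳ-≤ K (n≤1+n n)) ⟩
    K ∸ suc n                  ∎
    where
    open ≡-Reasoning
    K≤a+n : K ≤ a + n
    K≤a+n = s≤s⁻¹ (subst (K <_) (+-suc a n) (≰⇒> a+1+n≰K))

  growsAtEnds-blockOrder : a ≤ K → GrowsAtEnds x (suc K)
  growsAtEnds-blockOrder a≤K n 1+n<1+K with a + suc n ≤? K
  ... | yes a+1+n≤K = inj₂ (trans (visits-blockOrder-up (suc n) a+1+n≤K)
                              (trans (+-suc a n) (cong suc (sym (maxUpTo-blockOrder n (≤-trans (+-monoʳ-≤ a (n≤1+n n)) a+1+n≤K))))))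
  ... | no  a+1+n≰K = inj₁ (trans (cong suc (visits-blockOrder-down (suc n) (≰⇒> a+1+n≰K) 1+n≤K))
                              (trans (sym (+-∸-assoc 1 1+n≤K))
                                (sym (minUpTo-blockOrder-down a≤K n K≤a+n (<⇒≤ 1+n≤K)))))
    where
    1+n≤K = s≤s⁻¹ 1+n<1+K
    K≤a+n : K ≤ a + n
    K≤a+n = s≤s⁻¹ (subst (K <_) (+-suc a n) (≰⇒> a+1+n≰K))

sum-listOf : ∀ {p} (f : Fin p → ℕ) → sum (listOf f) ≡ ∑ f
sum-listOf f = trans (cong sum (listOf≡tabulate f)) (go f)
  where
  go : ∀ {p} (f : Fin p → ℕ) → sum (List.tabulate f) ≡ ∑ f
  go {zero}  f = refl
  go {suc p} f = cong (f fzero +_) (go (f ∘ fsuc))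

sum-toList : ∀ {p} (A : Vec ℕ p) → sum (Vec.toList A) ≡ weight A
sum-toList []      = refl
sum-toList (x ∷ A) = cong (x +_) (sum-toList A)

weight≡∑lookup : ∀ {p} (A : Vec ℕ p) → weight A ≡ ∑ (lookup A)
weight≡∑lookup []      = refl
weight≡∑lookup (x ∷ A) = cong (x +_) (weight≡∑lookup A)

sum-take≤sum : ∀ n xs → sum (take n xs) ≤ sum xs
sum-take≤sum n xs = subst (sum (take n xs) ≤_) (trans (sym (sum-++ (take n xs) (drop n xs))) (cong sum (take++drop≡id n xs)))
                          (m≤m+n _ _)

prefixSum≤weight : ∀ {p} (π : Permutation′ p) (A : Vec ℕ p) i → prefixSum π A i ≤ weight A
prefixSum≤weight π A i = ≤-trans (sum-take≤sum (suc (toℕ i)) (listOf f)) (≤-reflexive (begin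
  sum (listOf f)  ≡⟨ sum-listOf f ⟩
  ∑ f             ≡⟨ sym (sum-permute (lookup A) π) ⟩
  ∑ (lookup A)    ≡⟨ sym (weight≡∑lookup A) ⟩
  weight A        ∎))
  where
  open ≡-Reasoning
  f = λ j → lookup A (π ⟨$⟩ʳ j)

nth-listOf-lookup : ∀ {p} (π : Permutation′ p) (A : Vec ℕ p) {t} → t < p →
                    nth (listOf (λ j → lookup A (π ⟨$⟩ʳ j))) t ≡ nth (Vec.toList A) (visits π t)
nth-listOf-lookup π A t<p = trans (nth-listOf< _ t<p)
  (trans (sym (nth-toList A _)) (cong (nth (Vec.toList A)) (sym (nth-listOf< _ t<p))))

upperBound : ℕ → ℕ → ℕ → ℕ
upperBound k j n with n ≤? suc j
... | yes _ = n ⊓ j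
... | no  _ = k

upperBound-≤ : ∀ k {j n} → n ≤ suc j → upperBound k j n ≡ n ⊓ j
upperBound-≤ k {j} {n} n≤1+j with n ≤? suc j
... | yes _     = refl
... | no  n≰1+j = contradiction n≤1+j n≰1+j

upperBound-≰ : ∀ k {j n} → n ≰ suc j → upperBound k j n ≡ k
upperBound-≰ k {j} {n} n≰1+j with n ≤? suc j
... | yes n≤1+j = contradiction n≤1+j n≰1+j
... | no  _     = refl

upperBound≤ : ∀ k {j} n → j ≤ k → upperBound k j n ≤ k
upperBound≤ k {j} n j≤k with n ≤? suc j
... | yes _ = ≤-trans (m⊓n≤n n j) j≤k
... | no  _ = ≤-refl

upperString : (k j : ℕ) → Vec ℕ (suc (suc k))
upperString k j = Vec.tabulate (upperBound k j ∘ toℕ)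

upperString-≡targetString : ∀ k → upperString k k ≡ targetString k
upperString-≡targetString k = trans (tabulate-cong λ i → trans (upperBound-≤ k (s≤s⁻¹ (toℕ<n i))) (sym (lookup-targetString k i)))
                                    (tabulate∘lookup (targetString k))

upperString-≤lex-targetString : ∀ k {j} → j ≤ k → upperString k j ≤lex targetString k
upperString-≤lex-targetString k {j} j≤k = ≤lex-intro _ _ λ i agree →
  subst₂ _≤_ (sym (lookup∘tabulate (upperBound k j ∘ toℕ) i)) (sym (lookup-targetString k i)) (pointwise i agree)
  where
  pointwise : ∀ i → (∀ i′ → toℕ i′ < toℕ i → lookup (upperString k j) i′ ≡ lookup (targetString k) i′) →
              upperBound k j (toℕ i) ≤ toℕ i ⊓ k
  pointwise i agree with suc j <? toℕ i
  ... | no  1+j≮i = subst (_≤ toℕ i ⊓ k) (sym (upperBound-≤ k (≮⇒≥ 1+j≮i))) (⊓-monoʳ-≤ (toℕ i) j≤k)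
  ... | yes 1+j<i = contradiction j≡1+j (<⇒≢ (n<1+n j))
    where
    1+j≤k = s≤s⁻¹ (≤-trans 1+j<i (s≤s⁻¹ (toℕ<n i)))
    1+j<2+k = <-trans 1+j<i (toℕ<n i)
    i′ = fromℕ< 1+j<2+k
    j≡1+j : j ≡ suc j
    j≡1+j = begin
      j                                  ≡⟨ sym (m≥n⇒m⊓n≡n (n≤1+n j)) ⟩
      suc j ⊓ j                          ≡⟨ sym (upperBound-≤ k ≤-refl) ⟩
      upperBound k j (suc j)             ≡⟨ cong (upperBound k j) (sym (toℕ-fromℕ< 1+j<2+k)) ⟩
      upperBound k j (toℕ i′)            ≡⟨ sym (lookup∘tabulate (upperBound k j ∘ toℕ) i′) ⟩
      lookup (upperString k j) i′        ≡⟨ agree i′ (subst (_< toℕ i) (sym (toℕ-fromℕ< 1+j<2+k)) 1+j<i) ⟩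
      lookup (targetString k) i′         ≡⟨ lookup-targetString k i′ ⟩
      toℕ i′ ⊓ k                         ≡⟨ cong (_⊓ k) (toℕ-fromℕ< 1+j<2+k) ⟩
      suc j ⊓ k                          ≡⟨ m≤n⇒m⊓n≡m 1+j≤k ⟩
      suc j                              ∎
      where open ≡-Reasoning

replicate⁺ : ∀ {P : ℕ → Set} n {x : ℕ} → P x → All P (Vec.replicate n x)
replicate⁺ zero    px = []
replicate⁺ (suc n) px = px ∷ replicate⁺ n px

lookup-replicate-∷ʳ : ∀ n (x : ℕ) (i : Fin (suc n)) → lookup (Vec.replicate n x Vec.∷ʳ x) i ≡ x
lookup-replicate-∷ʳ zero    x fzero    = refl
lookup-replicate-∷ʳ (suc n) x fzero    = refl
lookup-replicate-∷ʳ (suc n) x (fsuc i) = lookup-replicate-∷ʳ n x i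

blockSearch : ∀ k → Fin (suc (suc k)) → Fin (suc k) → Search k (suc (suc k))
blockSearch k a j = record
  { π     = blockOrder (suc k) (toℕ a)
  ; conn  = growsAtEnds⇒connected {π = blockOrder (suc k) (toℕ a)} (growsAtEnds-blockOrder (suc k) (toℕ a) (s≤s⁻¹ (toℕ<n a)))
  ; L     = Vec.replicate _ 0
  ; U     = upperString k (toℕ j)
  ; L-bnd = replicate⁺ _ z≤n
  ; U-bnd = tabulate⁺ λ i → upperBound≤ k (toℕ i) (s≤s⁻¹ (toℕ<n j))
  }

blockSearch-covers : ∀ k (A : Vec ℕ (suc (suc k))) → weight A ≡ k →
                     ∀ a j → Window (Vec.toList A) (toℕ a) (toℕ j) → Covers (blockSearch k a j) A
blockSearch-covers k A wA a j win i =
  subst (_≤ prefixSum ρ A i) (sym (lookup-replicate-∷ʳ _ 0 (fsuc i))) z≤n ,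
  subst (prefixSum ρ A i ≤_) (sym (lookup∘tabulate (upperBound k (toℕ j) ∘ toℕ) i)) prefixSum≤upperBound
  where
  ρ = blockOrder (suc k) (toℕ a)
  xs = Vec.toList A
  a+1+j<2+k : toℕ a + suc (toℕ j) < suc (suc k)
  a+1+j<2+k = subst (toℕ a + suc (toℕ j) <_) (length-toList A) (window-inside xs win)
  along-window : ∀ t → t ≤ suc (toℕ j) → nth (listOf (λ m → lookup A (ρ ⟨$⟩ʳ m))) t ≡ nth (drop (toℕ a) xs) t
  along-window t t≤1+j = begin
    nth (listOf (λ m → lookup A (ρ ⟨$⟩ʳ m))) t  ≡⟨ nth-listOf-lookup ρ A (s≤s (m+n≤o⇒n≤o (toℕ a) a+t≤1+k)) ⟩
    nth xs (visits ρ t)                          ≡⟨ cong (nth xs) (visits-blockOrder-up (suc k) (toℕ a) t a+t≤1+k) ⟩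
    nth xs (toℕ a + t)                           ≡⟨ sym (nth-drop (toℕ a) xs t) ⟩
    nth (drop (toℕ a) xs) t                      ∎
    where
    open ≡-Reasoning
    a+t≤1+k = s≤s⁻¹ (≤-<-trans (+-monoʳ-≤ (toℕ a) t≤1+j) a+1+j<2+k)
  prefixSum≤upperBound : prefixSum ρ A i ≤ upperBound k (toℕ j) (toℕ i)
  prefixSum≤upperBound with suc (toℕ j) <? toℕ i
  ... | yes 1+j<i = ≤-trans (prefixSum≤weight ρ A i) (≤-reflexive (trans wA (sym (upperBound-≰ k (<⇒≱ 1+j<i)))))
  ... | no  1+j≮i = ≤-reflexive (begin
    prefixSum ρ A i                                           ≡⟨ prefixSum≡sumUpTo ρ A i ⟩
    sumUpTo (nth (listOf (λ m → lookup A (ρ ⟨$⟩ʳ m)))) (toℕ i) ≡⟨ foldUpTo-cong _+_ (toℕ i) (λ t t≤i → along-window t (≤-trans t≤i i≤1+j)) ⟩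
    sumUpTo (nth (drop (toℕ a) xs)) (toℕ i)                   ≡⟨ sumUpTo-zeroOnesZero (drop (toℕ a) xs) win (toℕ i) i≤1+j ⟩
    toℕ i ⊓ toℕ j                                             ≡⟨ sym (upperBound-≤ k i≤1+j) ⟩
    upperBound k (toℕ j) (toℕ i)                              ∎)
    where
    open ≡-Reasoning
    i≤1+j = ≮⇒≥ 1+j≮i

2+weight≤length : ∀ {k} (A : Vec ℕ (suc (suc k))) → weight A ≡ k → 2 + sum (Vec.toList A) ≤ length (Vec.toList A)
2+weight≤length A wA = ≤-reflexive (trans (cong (2 +_) (trans (sum-toList A) wA)) (sym (length-toList A)))

blockScheme : ∀ k → List (Search k (suc (suc k)))
blockScheme k = List.cartesianProductWith (blockSearch k) (List.allFin _) (List.allFin _)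

blockSearch∈blockScheme : ∀ k a j → blockSearch k a j ∈ blockScheme k
blockSearch∈blockScheme k a j = ∈-cartesianProductWith⁺ (blockSearch k) (∈-allFin a) (∈-allFin j)

blockScheme-isSearchScheme : ∀ k → IsSearchScheme (blockScheme k)
blockScheme-isSearchScheme k A wA with window (Vec.toList A) (2+weight≤length A wA)
... | a , j , win = lose (blockSearch∈blockScheme k a′ j′) (blockSearch-covers k A wA a′ j′ win′)
  where
  a+1+j<2+k = subst (a + suc j <_) (length-toList A) (window-inside (Vec.toList A) win)
  a<2+k = ≤-<-trans (m≤m+n a (suc j)) a+1+j<2+k
  j<1+k = s≤s⁻¹ (≤-<-trans (m≤n+m (suc j) a) a+1+j<2+k)
  a′ = fromℕ< a<2+k
  j′ = fromℕ< j<1+k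
  win′ = subst₂ (Window (Vec.toList A)) (sym (toℕ-fromℕ< a<2+k)) (sym (toℕ-fromℕ< j<1+k)) win

targetString-critical : ∀ k → IsCriticalString (blockScheme k) (targetString k)
targetString-critical k = target∈ , U≤target
  where
  target∈ : targetString k ∈ List.map U (blockScheme k)
  target∈ = subst (_∈ List.map U (blockScheme k))
                  (trans (cong (upperString k) (toℕ-fromℕ k)) (upperString-≡targetString k))
                  (∈-map⁺ U (blockSearch∈blockScheme k fzero (fromℕ k)))
  U≤target : ∀ S → S ∈ blockScheme k → U S ≤lex targetString k
  U≤target S S∈ with ∈-cartesianProductWith⁻ (blockSearch k) (List.allFin _) (List.allFin _) S∈
  ... | a , j , _ , _ , refl = upperString-≤lex-targetString k (s≤s⁻¹ (toℕ<n j))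

theorem2 : ∀ (k : ℕ) → k ≥ 1 → IsAlpha k (suc (suc k)) (targetString k)
theorem2 k _ = (blockScheme k , blockScheme-isSearchScheme k , targetString-critical k) ,
               targetString-≤lex-critical k
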